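{- Let $n\ge 1$ be an integer and let ${\bm M}=\mathrm{circ}(n,-1,-1,\ldots,-1)\in\mathbb{Z}^{n\times n}$ be the circulant matrix whose diagonal entries are all $n$ and whose off-diagonal entries are all $-1$. Let $G_{\bm M}=\mathrm{Cay}(\mathbb{Z}^n/{\bm M}\mathbb{Z}^n,\{\mathbf e_1,\ldots,\mathbf e_n\})$, where $\mathbf e_1,\ldots,\mathbf e_n$ are the images of the standard unit coordinate vectors of $\mathbb{Z}^n$. Then the diameter of $G_{\bm M}$ is $\binom{n}{2}=n(n-1)/2$.
   Context: For an Abelian group $\Gamma$ and a generating set $A\subseteq\Gamma$, the Cayley digraph $\mathrm{Cay}(\Gamma;A)$ has vertex set $\Gamma$ and an arc $(u,v)$ if and only if $v-u\in A$. Its diameter is the maximum, over ordered pairs of vertices $(u,v)$, of the length of a shortest directed path from $u$ to $v$. For a nonsingular integral $n\times n$ matrix ${\bm M}$, $\mathbb{Z}^n/{\bm M}\mathbb{Z}^n$ is the quotient of $\mathbb{Z}^n$ by the lattice generated by the columns of ${\bm M}$ (the group of integral vectors modulo ${\bm M}$). -}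

module Defs where

open import Data.Nat using (ℕ; zero; suc; _≤_; _<_)
open import Data.Integer using (ℤ; +_; _+_; _-_; _*_; -_)
open import Data.Fin using (Fin; zero; suc)
open import Data.Fin.Properties using (_≟_)
open import Data.Product using (Σ; ∃; _×_; _,_)
open import Relation.Nullary using (¬_; yes; no)
open import Relation.Binary.PropositionalEquality using (_≡_)

Vecℤ : ℕ → Set
Vecℤ n = Fin n → ℤ

Matℤ : ℕ → Set
Matℤ n = Fin n → Fin n → ℤ

sumℤ : ∀ {n} → (Fin n → ℤ) → ℤ
sumℤ {zero}  f = + 0
sumℤ {suc n} f = f zero + sumℤ (λ i → f (suc i))

_⊕_ : ∀ {n} → Vecℤ n → Vecℤ n → Vecℤ n
(u ⊕ v) i = u i + v i

_⊖_ : ∀ {n} → Vecℤ n → Vecℤ n → Vecℤ n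
(u ⊖ v) i = u i - v i

unit : ∀ {n} → Fin n → Vecℤ n
unit i j with i ≟ j
... | yes _ = + 1
... | no  _ = + 0

InLattice : ∀ {n} → Matℤ n → Vecℤ n → Set
InLattice {n} M x = Σ (Vecℤ n) λ c → ∀ i → x i ≡ sumℤ (λ j → M i j * c j)

_≡[_]_ : ∀ {n} → Vecℤ n → Matℤ n → Vecℤ n → Set
u ≡[ M ] v = InLattice M (u ⊖ v)

-- Cayley digraph Cay(ℤ^n / Mℤ^n ; {e_1,…,e_n}); vertices are represented by
-- integral vectors (classes modulo M). Arc (u,w) iff w - u ∈ {e_1,…,e_n} mod M.
Arc : ∀ {n} → Matℤ n → Vecℤ n → Vecℤ n → Set
Arc {n} M u w = Σ (Fin n) λ i → (w ⊖ u) ≡[ M ] unit i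

data Walk {n} (M : Matℤ n) : ℕ → Vecℤ n → Vecℤ n → Set where
  [] : ∀ {u v} → u ≡[ M ] v → Walk M zero u v
  _∷_ : ∀ {k u w v} → Arc M u w → Walk M k w v → Walk M (suc k) u v

Distance : ∀ {n} → Matℤ n → Vecℤ n → Vecℤ n → ℕ → Set
Distance M u v d = Walk M d u v × (∀ k → k < d → ¬ Walk M k u v)

Diameter : ∀ {n} → Matℤ n → ℕ → Set
Diameter {n} M D =
  (∀ (u v : Vecℤ n) → Σ ℕ λ d → d ≤ D × Distance M u v d)
  × Σ (Vecℤ n) λ u → Σ (Vecℤ n) λ v → Distance M u v D

circM : (n : ℕ) → Matℤ n
circM n i j with i ≟ j
... | yes _ = + n
... | no  _ = - (+ 1)

module Submission where

-- Write N = n+1.  Since M = N·I − J, a vector lies in Mℤⁿ iff it is congruent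
-- modulo N to a constant vector κ·(1,…,1).  A walk from u to v amounts to
-- weights a ∈ ℕⁿ (how often each eᵢ is used) with v − u ≡ a (mod M), its
-- length being ∑a.  So if rᵢ is the residue of vᵢ − uᵢ modulo N, the cheapest
-- weights for the offset c are aᵢ = (rᵢ + c) mod N, and the distance from u
-- to v is the minimum over c of  cost r c = ∑ᵢ ((rᵢ + c) mod N).  Counting
-- (cost r c + c is constant mod N, and the costs over one period of shifts
-- add up to n·(0 + 1 + ⋯ + n)) bounds that minimum by 0 + 1 + ⋯ + (n−1),
-- and for r = (0, 1, …, n−1) no shift does better.

open import Defs
open import Data.Nat using (ℕ; suc; _≤_)
open import Data.Nat.Combinatorics using (_C_)

module FiniteSums where

  open import Data.Nat hiding (_≟_)
  open import Data.Nat.Properties hiding (_≟_)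
  open import Data.Nat.DivMod using (_%_; %-distribˡ-+; m%n%n≡m%n)
  open import Data.Nat.Combinatorics using (nC1≡n; nCk+nC[k+1]≡[n+1]C[k+1])
  open import Data.Bool using (if_then_else_)
  open import Data.Fin using (Fin; zero; suc; toℕ; inject₁; fromℕ)
  open import Data.Fin.Properties using (_≟_; toℕ-inject₁; toℕ-fromℕ)
  open import Data.Product using (Σ; _×_; _,_)
  open import Relation.Nullary using (does)
  open import Relation.Binary.PropositionalEquality
  open ≡-Reasoning
  open import Algebra.Properties.CommutativeMonoid.Sum +-0-commutativeMonoid public
    using (sum; sum-syntax; sum-cong-≗; sum-replicate-zero; ∑-distrib-+; ∑-comm)
  open import Algebra.Properties.CommutativeMonoid.Sum +-0-commutativeMonoid
    using (sum-init-last)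

  ∑-const : ∀ n a → ∑[ i < n ] a ≡ n * a
  ∑-const zero    a = refl
  ∑-const (suc n) a = cong (a +_) (∑-const n a)

  ∑-mono-≤ : ∀ {n} {f g : Fin n → ℕ} → (∀ i → f i ≤ g i) → sum f ≤ sum g
  ∑-mono-≤ {zero}  f≤g = z≤n
  ∑-mono-≤ {suc n} f≤g = +-mono-≤ (f≤g zero) (∑-mono-≤ (λ i → f≤g (suc i)))

  ∑≡0⇒≡0 : ∀ {n} (a : Fin n → ℕ) → sum a ≡ 0 → ∀ i → a i ≡ 0
  ∑≡0⇒≡0 a e zero    = m+n≡0⇒m≡0 (a zero) e
  ∑≡0⇒≡0 a e (suc i) = ∑≡0⇒≡0 (λ j → a (suc j)) (m+n≡0⇒n≡0 (a zero) e) i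

  -- Kronecker delta, decided by the same test as the unit vectors of Defs.
  δ : ∀ {n} → Fin n → Fin n → ℕ
  δ i j = if does (i ≟ j) then 1 else 0

  ∑-δ : ∀ {n} (i : Fin n) → sum (δ i) ≡ 1
  ∑-δ {suc n} zero    = cong suc (sum-replicate-zero n)
  ∑-δ {suc n} (suc i) = ∑-δ i

  -- A weight vector of total weight k+1 is a unit vector plus a weight
  -- vector of total weight k; this lets a walk be built one arc at a time.
  ∑≡suc⇒split : ∀ {n} (a : Fin n → ℕ) k → sum a ≡ suc k →
    Σ (Fin n) λ i → Σ (Fin n → ℕ) λ a′ → (∀ j → a j ≡ δ i j + a′ j) × sum a′ ≡ k
  ∑≡suc⇒split {zero} a k ()
  ∑≡suc⇒split {suc n} a k total with a zero in a₀
  ... | suc p = zero , a′ , split , suc-injective total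
    where
    a′ : Fin (suc n) → ℕ
    a′ zero    = p
    a′ (suc j) = a (suc j)
    split : ∀ j → a j ≡ δ zero j + a′ j
    split zero    = a₀
    split (suc j) = refl
  ... | zero with ∑≡suc⇒split (λ j → a (suc j)) k total
  ...   | i , a′ , split , total′ = suc i , a″ , split′ , total′
    where
    a″ : Fin (suc n) → ℕ
    a″ zero    = 0
    a″ (suc j) = a′ j
    split′ : ∀ j → a j ≡ δ (suc i) j + a″ j
    split′ zero    = a₀
    split′ (suc j) = split j

  ∑-range-snoc : ∀ m (f : ℕ → ℕ) → ∑[ k < suc m ] f (toℕ k) ≡ ∑[ k < m ] f (toℕ k) + f m
  ∑-range-snoc m f = begin
    ∑[ k < suc m ] f (toℕ k)                           ≡⟨ sum-init-last (λ k → f (toℕ k)) ⟩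
    ∑[ k < m ] f (toℕ (inject₁ k)) + f (toℕ (fromℕ m))  ≡⟨ cong₂ _+_ (sum-cong-≗ {m} (λ k → cong f (toℕ-inject₁ k)))
                                                                     (cong f (toℕ-fromℕ m)) ⟩
    ∑[ k < m ] f (toℕ k) + f m                         ∎

  ∑-range-shift : ∀ m (f : ℕ → ℕ) → f m ≡ f 0 → ∑[ k < m ] f (suc (toℕ k)) ≡ ∑[ k < m ] f (toℕ k)
  ∑-range-shift zero    f _        = refl
  ∑-range-shift (suc m) f periodic = begin
    ∑[ k < suc m ] f (suc (toℕ k))     ≡⟨ ∑-range-snoc m (λ k → f (suc k)) ⟩
    ∑[ k < m ] f (suc (toℕ k)) + f (suc m) ≡⟨ cong (∑[ k < m ] f (suc (toℕ k)) +_) periodic ⟩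
    ∑[ k < m ] f (suc (toℕ k)) + f 0   ≡⟨ +-comm _ (f 0) ⟩
    f 0 + ∑[ k < m ] f (suc (toℕ k))   ∎

  ∑-% : ∀ {n} d .{{_ : NonZero d}} (f : Fin n → ℕ) → (∑[ i < n ] (f i % d)) % d ≡ sum f % d
  ∑-% {zero}  d f = refl
  ∑-% {suc n} d f = begin
    (f zero % d + S′) % d          ≡⟨ %-distribˡ-+ (f zero % d) S′ d ⟩
    (f zero % d % d + S′ % d) % d  ≡⟨ cong₂ (λ x y → (x + y) % d) (m%n%n≡m%n (f zero) d) (∑-% d (λ i → f (suc i))) ⟩
    (f zero % d + S % d) % d       ≡⟨ %-distribˡ-+ (f zero) S d ⟨
    (f zero + S) % d               ∎
    where
    S′ = ∑[ i < n ] (f (suc i) % d)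
    S  = ∑[ i < n ] f (suc i)

  triangle : ℕ → ℕ
  triangle m = ∑[ k < m ] toℕ k

  triangle-suc : ∀ m → triangle (suc m) ≡ triangle m + m
  triangle-suc m = ∑-range-snoc m (λ k → k)

  C2≡triangle : ∀ n → n C 2 ≡ triangle n
  C2≡triangle zero    = refl
  C2≡triangle (suc n) = begin
    suc n C 2       ≡⟨ nCk+nC[k+1]≡[n+1]C[k+1] n 1 ⟨
    n C 1 + n C 2   ≡⟨ cong₂ _+_ (nC1≡n n) (C2≡triangle n) ⟩
    n + triangle n  ≡⟨ +-comm n (triangle n) ⟩
    triangle n + n  ≡⟨ triangle-suc n ⟨
    triangle (suc n) ∎

module CyclicCost where

  open import Data.Nat hiding (_≟_)
  open import Data.Nat.Properties hiding (_≟_)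
  open import Data.Nat.DivMod
  open import Data.Nat.Solver using (module +-*-Solver)
  open +-*-Solver
  open import Data.Fin using (Fin; toℕ)
  open import Data.Fin.Properties using (toℕ<n)
  open import Data.List using (upTo)
  open import Data.List.Extrema.Nat using (argmin; f[argmin]≤f[xs])
  import Data.List.Relation.Unary.All as All
  open import Data.List.Membership.Propositional.Properties using (∈-upTo⁺)
  open import Data.Product using (Σ; _,_)
  open import Relation.Nullary using (yes; no)
  open import Relation.Binary.PropositionalEquality
  open import Data.Empty using (⊥-elim)
  open FiniteSums

  cost : ∀ {n} → (Fin n → ℕ) → ℕ → ℕ
  cost {n} r c = ∑[ i < n ] ((r i + c) % suc n)

  cost-periodic : ∀ {n} (r : Fin n → ℕ) c → cost r c ≡ cost r (c % suc n)
  cost-periodic {n} r c = sum-cong-≗ λ i → begin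
    (r i + c) % N                ≡⟨ %-distribˡ-+ (r i) c N ⟩
    (r i % N + c % N) % N        ≡⟨ cong (λ x → (r i % N + x) % N) (m%n%n≡m%n c N) ⟨
    (r i % N + c % N % N) % N    ≡⟨ %-distribˡ-+ (r i) (c % N) N ⟨
    (r i + c % N) % N            ∎
    where
    open ≡-Reasoning
    N = suc n

  -- cost r c + c ≡ ∑ r  (mod n+1): raising the shift by one lowers the
  -- residue of the cost by one.
  cost-residue : ∀ {n} (r : Fin n → ℕ) c → (cost r c + c) % suc n ≡ sum r % suc n
  cost-residue {n} r c = begin
    (cost r c + c) % N                       ≡⟨ %-distribˡ-+ (cost r c) c N ⟩
    (cost r c % N + c % N) % N               ≡⟨ cong (λ x → (x + c % N) % N) (∑-% N (λ i → r i + c)) ⟩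
    (S′ % N + c % N) % N                     ≡⟨ %-distribˡ-+ S′ c N ⟨
    (S′ + c) % N                             ≡⟨ cong (λ x → (x + c) % N) (trans (∑-distrib-+ r (λ _ → c)) (cong (sum r +_) (∑-const n c))) ⟩
    (sum r + n * c + c) % N                  ≡⟨ cong (_% N) (solve 3 (λ s n c → s :+ n :* c :+ c := s :+ c :* (con 1 :+ n)) refl (sum r) n c) ⟩
    (sum r + c * N) % N                      ≡⟨ [m+kn]%n≡m%n (sum r) c N ⟩
    sum r % N                                ∎
    where
    open ≡-Reasoning
    N  = suc n
    S′ = ∑[ i < n ] (r i + c)

  -- The residues of y, y+1, …, y+n modulo n+1 are 0, 1, …, n in some order.
  ∑-residues : ∀ n y → ∑[ k < suc n ] ((y + toℕ k) % suc n) ≡ triangle (suc n)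
  ∑-residues n zero    = sum-cong-≗ {suc n} λ k → m<n⇒m%n≡m (toℕ<n k)
  ∑-residues n (suc y) = begin
    ∑[ k < N ] ((suc y + toℕ k) % N)    ≡⟨ sum-cong-≗ {N} (λ k → cong (_% N) (sym (+-suc y (toℕ k)))) ⟩
    ∑[ k < N ] ((y + suc (toℕ k)) % N)  ≡⟨ ∑-range-shift N (λ k → (y + k) % N) periodic ⟩
    ∑[ k < N ] ((y + toℕ k) % N)      ≡⟨ ∑-residues n y ⟩
    triangle N                         ∎
    where
    open ≡-Reasoning
    N = suc n
    periodic : (y + N) % N ≡ (y + 0) % N
    periodic = trans ([m+n]%n≡m%n y N) (cong (_% N) (sym (+-identityʳ y)))

  -- Over a full period of shifts every coordinate contributes 0 + 1 + ⋯ + n.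
  cost-over-period : ∀ {n} (r : Fin n → ℕ) c → ∑[ k < suc n ] cost r (c + toℕ k) ≡ n * triangle (suc n)
  cost-over-period {n} r c = begin
    ∑[ k < N ] ∑[ i < n ] ((r i + (c + toℕ k)) % N)  ≡⟨ ∑-comm {N} {n} (λ k i → (r i + (c + toℕ k)) % N) ⟩
    ∑[ i < n ] ∑[ k < N ] ((r i + (c + toℕ k)) % N)  ≡⟨ sum-cong-≗ {n} (λ i → trans (sum-cong-≗ {N} (λ k → cong (_% N) (sym (+-assoc (r i) c (toℕ k)))))
                                                                              (∑-residues n (r i + c))) ⟩
    ∑[ i < n ] triangle N                            ≡⟨ ∑-const n (triangle N) ⟩
    n * triangle N                                   ∎
    where
    open ≡-Reasoning
    N = suc n

  %-gap : ∀ d .{{_ : NonZero d}} {a b} → a % d ≡ b % d → b < a → b + d ≤ a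
  %-gap d {a} {b} a≡b b<a with a / d ≤? b / d
  ... | yes a/d≤b/d = ⊥-elim (<⇒≱ b<a (begin
    a                  ≡⟨ m≡m%n+[m/n]*n a d ⟩
    a % d + a / d * d  ≤⟨ +-mono-≤ (≤-reflexive a≡b) (*-monoˡ-≤ d a/d≤b/d) ⟩
    b % d + b / d * d  ≡⟨ m≡m%n+[m/n]*n b d ⟨
    b                  ∎))
    where open ≤-Reasoning
  ... | no a/d≰b/d = begin
    b + d                        ≡⟨ cong (_+ d) (m≡m%n+[m/n]*n b d) ⟩
    b % d + b / d * d + d        ≡⟨ solve 3 (λ r q d → r :+ q :* d :+ d := r :+ (con 1 :+ q) :* d) refl (b % d) (b / d) d ⟩
    b % d + suc (b / d) * d      ≤⟨ +-mono-≤ (≤-reflexive (sym a≡b)) (*-monoˡ-≤ d (≰⇒> a/d≰b/d)) ⟩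
    a % d + a / d * d            ≡⟨ m≡m%n+[m/n]*n a d ⟨
    a                            ∎
    where open ≤-Reasoning

  -- Some shift minimises the cost; it suffices to search one period.
  cost-minimiser : ∀ {n} (r : Fin n → ℕ) → Σ ℕ λ c₀ → ∀ c → cost r c₀ ≤ cost r c
  cost-minimiser {n} r = c₀ , λ c → subst (cost r c₀ ≤_) (sym (cost-periodic r c))
    (All.lookup (f[argmin]≤f[xs] {f = cost r} 0 (upTo (suc n))) (∈-upTo⁺ (m%n<n c (suc n))))
    where
    c₀ = argmin (cost r) 0 (upTo (suc n))

  -- If c₀ minimises the cost then a later shift c₀ + j pays for its delay:
  -- cost + shift at c₀ + j is congruent to, and larger than, cost + shift at
  -- c₀ (by cost-residue), hence larger by at least n+1.
  later-shift-gap : ∀ {n} (r : Fin n → ℕ) c₀ → (∀ c → cost r c₀ ≤ cost r c) →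
    ∀ j → 0 < j → cost r c₀ + suc n ≤ cost r (c₀ + j) + j
  later-shift-gap {n} r c₀ minimal j 0<j = +-cancelˡ-≤ c₀ (m₀ + N) (cost r (c₀ + j) + j) (subst₂ _≤_
    (solve 3 (λ m c N → m :+ c :+ N := c :+ (m :+ N)) refl m₀ c₀ N)
    (solve 3 (λ a c j → a :+ (c :+ j) := c :+ (a :+ j)) refl (cost r (c₀ + j)) c₀ j)
    (%-gap N (trans (cost-residue r (c₀ + j)) (sym (cost-residue r c₀)))
             (+-mono-≤-< (minimal (c₀ + j)) (m<m+n c₀ 0<j))))
    where
    N  = suc n
    m₀ = cost r c₀

  -- The minimal cost is at most 0 + 1 + ⋯ + (n−1): summing later-shift-gap
  -- over j = 1, …, n and comparing with the total over one period
  -- (cost-over-period) gives (n+1)·cost r c₀ ≤ (n+1)·(0 + 1 + ⋯ + (n−1)).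
  min-cost-bound : ∀ {n} (r : Fin n → ℕ) c₀ → (∀ c → cost r c₀ ≤ cost r c) → cost r c₀ ≤ triangle n
  min-cost-bound {n} r c₀ minimal = *-cancelˡ-≤ N (+-cancelʳ-≤ (n * N) (N * m₀) (N * triangle n) (begin
    N * m₀ + n * N                      ≡⟨ solve 2 (λ n m → (con 1 :+ n) :* m :+ n :* (con 1 :+ n) := m :+ n :* (m :+ (con 1 :+ n))) refl n m₀ ⟩
    m₀ + n * (m₀ + N)                   ≤⟨ +-monoʳ-≤ m₀ later-shifts ⟩
    m₀ + (sum A + triangle N)           ≡⟨ +-assoc m₀ (sum A) (triangle N) ⟨
    m₀ + sum A + triangle N             ≡⟨ cong (_+ triangle N) whole-period ⟩
    n * triangle N + triangle N         ≡⟨ cong (λ t → n * t + t) (triangle-suc n) ⟩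
    n * (triangle n + n) + (triangle n + n) ≡⟨ solve 2 (λ n t → n :* (t :+ n) :+ (t :+ n) := (con 1 :+ n) :* t :+ n :* (con 1 :+ n)) refl n (triangle n) ⟩
    N * triangle n + n * N              ∎))
    where
    open ≤-Reasoning
    N  = suc n
    m₀ = cost r c₀
    A : Fin n → ℕ
    A j = cost r (c₀ + suc (toℕ j))
    later-shifts : n * (m₀ + N) ≤ sum A + triangle N
    later-shifts = begin
      n * (m₀ + N)                    ≡⟨ ∑-const n (m₀ + N) ⟨
      ∑[ j < n ] (m₀ + N)             ≤⟨ ∑-mono-≤ {n} (λ j → later-shift-gap r c₀ minimal (suc (toℕ j)) z<s) ⟩
      ∑[ j < n ] (A j + suc (toℕ j))  ≡⟨ ∑-distrib-+ A (λ j → suc (toℕ j)) ⟩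
      sum A + triangle N              ∎
    whole-period : m₀ + sum A ≡ n * triangle N
    whole-period = trans (cong (λ c → cost r c + sum A) (sym (+-identityʳ c₀))) (cost-over-period r c₀)

  staircase-cost : ∀ n c → triangle n ≤ cost {n} toℕ c
  staircase-cost n c = +-cancelʳ-≤ ((c + n) % N) _ _ (begin
    triangle n + (c + n) % N          ≤⟨ +-monoʳ-≤ (triangle n) (s≤s⁻¹ (m%n<n (c + n) N)) ⟩
    triangle n + n                    ≡⟨ triangle-suc n ⟨
    triangle N                        ≡⟨ ∑-residues n c ⟨
    ∑[ k < N ] ((c + toℕ k) % N)      ≡⟨ ∑-range-snoc n (λ k → (c + k) % N) ⟩
    ∑[ k < n ] ((c + toℕ k) % N) + (c + n) % N
                                      ≡⟨ cong (_+ (c + n) % N) (sum-cong-≗ {n} (λ k → cong (_% N) (+-comm c (toℕ k)))) ⟩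
    cost {n} toℕ c + (c + n) % N      ∎)
    where
    open ≤-Reasoning
    N = suc n

  staircase-cost-zero : ∀ n → cost {n} toℕ 0 ≡ triangle n
  staircase-cost-zero n = sum-cong-≗ {n} λ i →
    trans (cong (_% suc n) (+-identityʳ (toℕ i))) (m<n⇒m%n≡m (m<n⇒m<1+n (toℕ<n i)))

module IntegerVectors where

  open import Data.Nat using (ℕ; zero; suc)
  open import Data.Fin using (Fin; zero; suc)
  open import Data.Fin.Properties using (_≟_)
  open import Data.Integer using (ℤ; +_; -_; _+_; _*_)
  import Data.Integer.Properties as ℤ
  open import Data.Integer.Solver using (module +-*-Solver)
  open +-*-Solver
  open import Relation.Nullary using (yes; no)
  open import Relation.Binary.PropositionalEquality
  open FiniteSums using (δ)

  sumℤ-cong : ∀ {n} {f g : Fin n → ℤ} → (∀ j → f j ≡ g j) → sumℤ f ≡ sumℤ g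
  sumℤ-cong {zero}  _   = refl
  sumℤ-cong {suc n} f≡g = cong₂ _+_ (f≡g zero) (sumℤ-cong (λ j → f≡g (suc j)))

  sumℤ-+ : ∀ {n} (f g : Fin n → ℤ) → sumℤ (λ j → f j + g j) ≡ sumℤ f + sumℤ g
  sumℤ-+ {zero}  f g = refl
  sumℤ-+ {suc n} f g = trans (cong (_+_ (f zero + g zero)) (sumℤ-+ (λ j → f (suc j)) (λ j → g (suc j))))
    (solve 4 (λ a b c d → (a :+ b) :+ (c :+ d) := (a :+ c) :+ (b :+ d)) refl
      (f zero) (g zero) (sumℤ (λ j → f (suc j))) (sumℤ (λ j → g (suc j))))

  sumℤ-neg : ∀ {n} (f : Fin n → ℤ) → sumℤ (λ j → - f j) ≡ - sumℤ f
  sumℤ-neg {zero}  f = refl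
  sumℤ-neg {suc n} f = trans (cong (_+_ (- f zero)) (sumℤ-neg (λ j → f (suc j))))
    (sym (ℤ.neg-distrib-+ (f zero) (sumℤ (λ j → f (suc j)))))

  sumℤ-*ˡ : ∀ {n} (a : ℤ) (f : Fin n → ℤ) → sumℤ (λ j → a * f j) ≡ a * sumℤ f
  sumℤ-*ˡ {zero}  a f = sym (ℤ.*-zeroʳ a)
  sumℤ-*ˡ {suc n} a f = trans (cong (_+_ (a * f zero)) (sumℤ-*ˡ a (λ j → f (suc j))))
    (sym (ℤ.*-distribˡ-+ a (f zero) (sumℤ (λ j → f (suc j)))))

  sumℤ-const : ∀ n (a : ℤ) → sumℤ {n} (λ _ → a) ≡ + n * a
  sumℤ-const zero    a = refl
  sumℤ-const (suc n) a = trans (cong (_+_ a) (sumℤ-const n a))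
    (solve 2 (λ n a → a :+ n :* a := (con (+ 1) :+ n) :* a) refl (+ n) a)

  sumℤ-δ : ∀ {n} (i : Fin n) (c : Fin n → ℤ) → sumℤ (λ j → + δ i j * c j) ≡ c i
  sumℤ-δ {suc n} zero c = begin
    + 1 * c zero + sumℤ (λ j → + 0 * c (suc j))  ≡⟨ cong₂ _+_ (ℤ.*-identityˡ (c zero)) (sumℤ-const n (+ 0)) ⟩
    c zero + + n * + 0                           ≡⟨ cong (_+_ (c zero)) (ℤ.*-zeroʳ (+ n)) ⟩
    c zero + + 0                                 ≡⟨ ℤ.+-identityʳ (c zero) ⟩
    c zero                                       ∎
    where open ≡-Reasoning
  sumℤ-δ {suc n} (suc i) c = trans (ℤ.+-identityˡ _) (sumℤ-δ i (λ j → c (suc j)))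

  ↑_ : ∀ {n} → (Fin n → ℕ) → Vecℤ n
  (↑ a) i = + a i

  unit≡δ : ∀ {n} (i j : Fin n) → unit i j ≡ + δ i j
  unit≡δ i j with i ≟ j
  ... | yes _ = refl
  ... | no  _ = refl

-- For an arbitrary integral matrix M, a walk of length k from u to v in
-- Cay(ℤⁿ/Mℤⁿ; e₁,…,eₙ) is the same as a weight vector a ∈ ℕⁿ of total
-- weight k with v − u ≡ a (mod M): an arc along eᵢ adds one to aᵢ.
module CayleyWalks {n} (M : Matℤ n) where

  open import Data.Nat as ℕ using (ℕ; zero; suc)
  open import Data.Fin using (Fin)
  open import Data.Integer using (+_; -_; _+_; _-_; _*_)
  import Data.Integer.Properties as ℤ
  open import Data.Integer.Solver using (module +-*-Solver)
  open +-*-Solver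
  open import Data.Product using (Σ; _×_; _,_)
  open import Relation.Binary.PropositionalEquality
  open FiniteSums using (sum; sum-replicate-zero; ∑-distrib-+; δ; ∑-δ; ∑≡0⇒≡0; ∑≡suc⇒split)
  open IntegerVectors

  lattice-cong : ∀ {x y : Vecℤ n} → (∀ i → x i ≡ y i) → InLattice M x → InLattice M y
  lattice-cong x≡y (c , x≡Mc) = c , λ i → trans (sym (x≡y i)) (x≡Mc i)

  lattice-0 : ∀ {x : Vecℤ n} → (∀ i → x i ≡ + 0) → InLattice M x
  lattice-0 x≡0 = (λ _ → + 0) , λ i → trans (x≡0 i) (sym (begin
    sumℤ (λ j → M i j * + 0)  ≡⟨ sumℤ-cong (λ j → ℤ.*-zeroʳ (M i j)) ⟩
    sumℤ {n} (λ _ → + 0)      ≡⟨ sumℤ-const n (+ 0) ⟩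
    + n * + 0                 ≡⟨ ℤ.*-zeroʳ (+ n) ⟩
    + 0                       ∎))
    where open ≡-Reasoning

  lattice-+ : ∀ {x y : Vecℤ n} → InLattice M x → InLattice M y → InLattice M (x ⊕ y)
  lattice-+ (c , x≡Mc) (c′ , y≡Mc′) = c ⊕ c′ , λ i → trans (cong₂ _+_ (x≡Mc i) (y≡Mc′ i))
    (sym (trans (sumℤ-cong (λ j → ℤ.*-distribˡ-+ (M i j) (c j) (c′ j)))
                (sumℤ-+ (λ j → M i j * c j) (λ j → M i j * c′ j))))

  lattice-neg : ∀ {x : Vecℤ n} → InLattice M x → InLattice M (λ i → - x i)
  lattice-neg (c , x≡Mc) = (λ j → - c j) , λ i → trans (cong -_ (x≡Mc i))
    (sym (trans (sumℤ-cong (λ j → sym (ℤ.neg-distribʳ-* (M i j) (c j))))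
                (sumℤ-neg (λ j → M i j * c j))))

  walk⇒weights : ∀ {k u v} → Walk M k u v →
    Σ (Fin n → ℕ) λ a → sum a ≡ k × (v ⊖ u) ≡[ M ] (↑ a)
  walk⇒weights {u = u} {v} ([] u≡v) = (λ _ → 0) , sum-replicate-zero n ,
    lattice-cong (λ i → solve 2 (λ u v → :- (u :- v) := (v :- u) :- con (+ 0)) refl (u i) (v i))
                 (lattice-neg u≡v)
  walk⇒weights {u = u} {v} (_∷_ {w = w} (i , u→w) rest) with walk⇒weights rest
  ... | a , total , v-w≡a = (λ j → δ i j ℕ.+ a j) ,
    trans (∑-distrib-+ (δ i) a) (cong₂ ℕ._+_ (∑-δ i) total) ,
    lattice-cong (λ j → begin
        ((w j - u j) - unit i j) + ((v j - w j) - + a j)  ≡⟨ cong (λ e → ((w j - u j) - e) + ((v j - w j) - + a j)) (unit≡δ i j) ⟩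
        ((w j - u j) - + δ i j) + ((v j - w j) - + a j)   ≡⟨ solve 5 (λ w u v d a → ((w :- u) :- d) :+ ((v :- w) :- a) := (v :- u) :- (d :+ a))
                                                               refl (w j) (u j) (v j) (+ δ i j) (+ a j) ⟩
        (v j - u j) - (+ δ i j + + a j)                   ≡⟨ cong (λ e → (v j - u j) - e) (ℤ.pos-+ (δ i j) (a j)) ⟨
        (v j - u j) - + (δ i j ℕ.+ a j)                   ∎)
      (lattice-+ u→w v-w≡a)
    where open ≡-Reasoning

  weights⇒walk : ∀ k (a : Fin n → ℕ) u v → sum a ≡ k → (v ⊖ u) ≡[ M ] (↑ a) → Walk M k u v
  weights⇒walk zero a u v total v-u≡a = [] (lattice-cong (λ i → begin
      - ((v i - u i) - + a i)   ≡⟨ cong (λ e → - ((v i - u i) - + e)) (∑≡0⇒≡0 a total i) ⟩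
      - ((v i - u i) - + 0)     ≡⟨ solve 2 (λ u v → :- ((v :- u) :- con (+ 0)) := u :- v) refl (u i) (v i) ⟩
      u i - v i                 ∎)
    (lattice-neg v-u≡a))
    where open ≡-Reasoning
  weights⇒walk (suc k) a u v total v-u≡a with ∑≡suc⇒split a k total
  ... | i , a′ , split , total′ = (i , step) ∷ weights⇒walk k a′ (u ⊕ unit i) v total′ (lattice-cong rest v-u≡a)
    where
    open ≡-Reasoning
    step : ((u ⊕ unit i) ⊖ u) ≡[ M ] unit i
    step = lattice-0 (λ j → solve 2 (λ u e → ((u :+ e) :- u) :- e := con (+ 0)) refl (u j) (unit i j))
    rest : ∀ j → (v j - u j) - + a j ≡ (v j - (u j + unit i j)) - + a′ j
    rest j = begin
      (v j - u j) - + a j                     ≡⟨ cong (λ e → (v j - u j) - e) (trans (cong +_ (split j)) (ℤ.pos-+ (δ i j) (a′ j))) ⟩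
      (v j - u j) - (+ δ i j + + a′ j)        ≡⟨ solve 4 (λ v u d a → (v :- u) :- (d :+ a) := (v :- (u :+ d)) :- a) refl (v j) (u j) (+ δ i j) (+ a′ j) ⟩
      (v j - (u j + + δ i j)) - + a′ j        ≡⟨ cong (λ e → (v j - (u j + e)) - + a′ j) (unit≡δ i j) ⟨
      (v j - (u j + unit i j)) - + a′ j       ∎

-- The circulant M = circ(n, −1, …, −1) = (n+1)·I − J.
module Circulant where

  open import Data.Nat as ℕ using (ℕ; suc; NonZero; _≤_; _<_)
  import Data.Nat.Properties as ℕ
  open import Data.Nat.DivMod using (_%_; _/_; [m+kn]%n≡m%n; m%n≤m; m<n⇒m%n≡m)
  open import Data.Fin using (Fin; toℕ)
  open import Data.Fin.Properties using (_≟_; toℕ<n)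
  open import Data.Integer using (ℤ; +_; -_; -[1+_]; _+_; _-_; _*_; _%ℕ_; _/ℕ_)
  import Data.Integer.Properties as ℤ
  open import Data.Integer.DivMod using (a≡a%ℕn+[a/ℕn]*n)
  open import Data.Integer.Solver using (module +-*-Solver)
  open +-*-Solver
  open import Data.Product using (Σ; _×_; _,_)
  open import Data.Empty using (⊥)
  open import Relation.Nullary using (yes; no)
  open import Relation.Binary.PropositionalEquality
  open ≡-Reasoning
  open FiniteSums using (sum-cong-≗; ∑-mono-≤; δ; triangle)
  open CyclicCost
  open IntegerVectors
  open CayleyWalks using (walk⇒weights; weights⇒walk)

  circ-entry : ∀ n (i j : Fin n) (x : ℤ) → circM n i j * x ≡ + suc n * (+ δ i j * x) - x
  circ-entry n i j x with i ≟ j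
  ... | yes _ = solve 2 (λ n x → n :* x := (con (+ 1) :+ n) :* (con (+ 1) :* x) :- x) refl (+ n) x
  ... | no  _ = solve 2 (λ n x → con (- + 1) :* x := (con (+ 1) :+ n) :* (con (+ 0) :* x) :- x) refl (+ n) x

  circ-· : ∀ n (c : Vecℤ n) i → sumℤ (λ j → circM n i j * c j) ≡ + suc n * c i - sumℤ c
  circ-· n c i = begin
    sumℤ (λ j → circM n i j * c j)                            ≡⟨ sumℤ-cong (λ j → circ-entry n i j (c j)) ⟩
    sumℤ (λ j → + suc n * (+ δ i j * c j) + - c j)            ≡⟨ sumℤ-+ (λ j → + suc n * (+ δ i j * c j)) (λ j → - c j) ⟩
    sumℤ (λ j → + suc n * (+ δ i j * c j)) + sumℤ (λ j → - c j)
                                                              ≡⟨ cong₂ _+_ (sumℤ-*ˡ (+ suc n) (λ j → + δ i j * c j)) (sumℤ-neg c) ⟩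
    + suc n * sumℤ (λ j → + δ i j * c j) - sumℤ c             ≡⟨ cong (λ y → + suc n * y - sumℤ c) (sumℤ-δ i c) ⟩
    + suc n * c i - sumℤ c                                    ∎

  ConstantModulo : ∀ n → Vecℤ n → Set
  ConstantModulo n x = Σ ℤ λ κ → Σ (Vecℤ n) λ q → ∀ i → x i ≡ κ + + suc n * q i

  lattice⇒constant : ∀ {n} {x : Vecℤ n} → InLattice (circM n) x → ConstantModulo n x
  lattice⇒constant {n} (c , x≡Mc) = - sumℤ c , c , λ i →
    trans (x≡Mc i) (trans (circ-· n c i) (ℤ.+-comm (+ suc n * c i) (- sumℤ c)))

  -- Conversely κ + (n+1)q = M c for cⱼ = κ + ∑q + qⱼ.
  constant⇒lattice : ∀ {n} {x : Vecℤ n} → ConstantModulo n x → InLattice (circM n) x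
  constant⇒lattice {n} (κ , q , x≡) = c , λ i → trans (x≡ i) (sym (begin
    sumℤ (λ j → circM n i j * c j)             ≡⟨ circ-· n c i ⟩
    + suc n * c i - sumℤ c                     ≡⟨ cong (_-_ (+ suc n * c i)) (trans (sumℤ-+ (λ _ → K) q)
                                                                                     (cong (_+ sumℤ q) (sumℤ-const n K))) ⟩
    + suc n * (K + q i) - (+ n * K + sumℤ q)   ≡⟨ solve 4 (λ n κ Q x → (con (+ 1) :+ n) :* ((κ :+ Q) :+ x) :- (n :* (κ :+ Q) :+ Q)
                                                                  := κ :+ (con (+ 1) :+ n) :* x) refl (+ n) κ (sumℤ q) (q i) ⟩
    κ + + suc n * q i                          ∎))
    where
    K = κ + sumℤ q
    c : Vecℤ n
    c j = K + q j

  residues : ∀ {n} → Vecℤ n → Vecℤ n → Fin n → ℕ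
  residues {n} u v i = (v i - u i) %ℕ suc n

  ≡-mod-from-ℤ : ∀ d .{{_ : NonZero d}} a b (z : ℤ) → + a ≡ + b + z * + d → a % d ≡ b % d
  ≡-mod-from-ℤ d a b (+ m) e = trans (cong (_% d) (ℤ.+-injective (trans e pos-linear))) ([m+kn]%n≡m%n b m d)
    where
    pos-linear : + b + + m * + d ≡ + (b ℕ.+ m ℕ.* d)
    pos-linear = trans (cong (_+_ (+ b)) (sym (ℤ.pos-* m d))) (sym (ℤ.pos-+ b (m ℕ.* d)))
  ≡-mod-from-ℤ d a b -[1+ m ] e = sym (≡-mod-from-ℤ d b a (+ suc m) (begin
    + b                                     ≡⟨ solve 3 (λ b z d → b := (b :+ z :* d) :+ (:- z) :* d) refl (+ b) -[1+ m ] (+ d) ⟩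
    (+ b + -[1+ m ] * + d) + + suc m * + d  ≡⟨ cong (λ y → y + + suc m * + d) e ⟨
    + a + + suc m * + d                     ∎))

  -- A walk of length k forces k ≥ cost r c for the shift c ≡ −κ, where
  -- v − u − a ≡ κ·(1,…,1): each weight aᵢ is congruent to rᵢ + c.
  walk⇒cost : ∀ {n k} {u v : Vecℤ n} → Walk (circM n) k u v → Σ ℕ λ c → cost (residues u v) c ≤ k
  walk⇒cost {n} {k} {u} {v} walk with walk⇒weights (circM n) walk
  ... | a , total , v-u≡a with lattice⇒constant v-u≡a
  ...   | κ , q , v-u-a≡κ+Nq = c , subst (cost r c ≤_) total (∑-mono-≤ residue≤weight)
    where
    N = suc n
    r = residues u v
    c = (- κ) %ℕ N
    residue≤weight : ∀ i → (r i ℕ.+ c) % N ≤ a i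
    residue≤weight i = subst (_≤ a i) (≡-mod-from-ℤ N (a i) (r i ℕ.+ c) z weight) (m%n≤m (a i) N)
      where
      x = v i - u i
      z = x /ℕ N + (- κ) /ℕ N - q i
      weight : + a i ≡ + (r i ℕ.+ c) + z * + N
      weight = begin
        + a i                      ≡⟨ solve 2 (λ x a → a := x :- (x :- a)) refl x (+ a i) ⟩
        x - (x - + a i)            ≡⟨ cong (_-_ x) (v-u-a≡κ+Nq i) ⟩
        x - (κ + + N * q i)        ≡⟨ solve 4 (λ x k N q → x :- (k :+ N :* q) := x :+ (:- k) :- N :* q) refl x κ (+ N) (q i) ⟩
        x + (- κ) - + N * q i      ≡⟨ cong₂ (λ y y′ → y + y′ - + N * q i) (a≡a%ℕn+[a/ℕn]*n x N) (a≡a%ℕn+[a/ℕn]*n (- κ) N) ⟩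
        (+ r i + x /ℕ N * + N) + (+ c + (- κ) /ℕ N * + N) - + N * q i
                                   ≡⟨ solve 6 (λ r s c t q N → (r :+ s :* N) :+ (c :+ t :* N) :- N :* q := (r :+ c) :+ (s :+ t :- q) :* N)
                                        refl (+ r i) (x /ℕ N) (+ c) ((- κ) /ℕ N) (q i) (+ N) ⟩
        (+ r i + + c) + z * + N    ≡⟨ cong (_+ z * + N) (ℤ.pos-+ (r i) c) ⟨
        + (r i ℕ.+ c) + z * + N    ∎

  cost⇒walk : ∀ {n} (u v : Vecℤ n) c → Walk (circM n) (cost (residues u v) c) u v
  cost⇒walk {n} u v c = weights⇒walk (circM n) _ a u v refl (constant⇒lattice (- + c , q , v-u-a≡))
    where
    N = suc n
    r = residues u v
    a : Fin n → ℕ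
    a i = (r i ℕ.+ c) % N
    q : Vecℤ n
    q i = (v i - u i) /ℕ N + + ((r i ℕ.+ c) / N)
    v-u-a≡ : ∀ i → (v i - u i) - + a i ≡ - + c + + N * q i
    v-u-a≡ i = begin
      x - + a i                                    ≡⟨ cong (_- + a i) (a≡a%ℕn+[a/ℕn]*n x N) ⟩
      (+ r i + s * + N) - + a i                    ≡⟨ solve 5 (λ r s N A c → (r :+ s :* N) :- A := (r :+ c) :- A :- c :+ s :* N)
                                                        refl (+ r i) s (+ N) (+ a i) (+ c) ⟩
      (+ r i + + c) - + a i - + c + s * + N        ≡⟨ cong (λ y → y - + a i - + c + s * + N)
                                                        (trans (sym (ℤ.pos-+ (r i) c)) (a≡a%ℕn+[a/ℕn]*n (+ (r i ℕ.+ c)) N)) ⟩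
      (+ a i + + w * + N) - + a i - + c + s * + N  ≡⟨ solve 5 (λ A w N c s → (A :+ w :* N) :- A :- c :+ s :* N := :- c :+ N :* (s :+ w))
                                                        refl (+ a i) (+ w) (+ N) (+ c) s ⟩
      - + c + + N * q i                            ∎
      where
      x = v i - u i
      s = x /ℕ N
      w = (r i ℕ.+ c) / N

  distance-is-min-cost : ∀ {n} (u v : Vecℤ n) c₀ → (∀ c → cost (residues u v) c₀ ≤ cost (residues u v) c) →
    Distance (circM n) u v (cost (residues u v) c₀)
  distance-is-min-cost u v c₀ minimal = cost⇒walk u v c₀ , λ k k<d walk → no-shorter k k<d (walk⇒cost walk)
    where
    no-shorter : ∀ k → k < cost (residues u v) c₀ → Σ ℕ (λ c → cost (residues u v) c ≤ k) → ⊥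
    no-shorter k k<d (c , cost≤k) = ℕ.<⇒≱ k<d (ℕ.≤-trans (minimal c) cost≤k)

  distance-bounded : ∀ {n} (u v : Vecℤ n) → Σ ℕ λ d → d ≤ triangle n × Distance (circM n) u v d
  distance-bounded {n} u v = at-minimiser (cost-minimiser (residues u v))
    where
    at-minimiser : Σ ℕ (λ c₀ → ∀ c → cost (residues u v) c₀ ≤ cost (residues u v) c) →
                   Σ ℕ λ d → d ≤ triangle n × Distance (circM n) u v d
    at-minimiser (c₀ , minimal) = cost (residues u v) c₀ ,
                                  min-cost-bound (residues u v) c₀ minimal ,
                                  distance-is-min-cost u v c₀ minimal

  origin staircase : ∀ {n} → Vecℤ n
  origin      _ = + 0
  staircase i = + toℕ i

  staircase-distance : ∀ n → Distance (circM n) origin staircase (triangle n)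
  staircase-distance n = subst (Distance (circM n) origin staircase) (trans (cost≡ 0) (staircase-cost-zero n))
    (distance-is-min-cost origin staircase 0 λ c → subst₂ _≤_ (sym (cost≡ 0)) (sym (cost≡ c))
      (ℕ.≤-trans (ℕ.≤-reflexive (staircase-cost-zero n)) (staircase-cost n c)))
    where
    cost≡ : ∀ c → cost (residues {n} origin staircase) c ≡ cost {n} toℕ c
    cost≡ c = sum-cong-≗ {n} λ i →
      cong (λ y → (y ℕ.+ c) % suc n) (trans (cong (_% suc n) (ℕ.+-identityʳ (toℕ i))) (m<n⇒m%n≡m (ℕ.m<n⇒m<1+n (toℕ<n i))))

open import Data.Product using (Σ; _×_; _,_)
open import Relation.Binary.PropositionalEquality using (_≡_; subst; sym)
open FiniteSums using (triangle; C2≡triangle)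
open Circulant using (distance-bounded; origin; staircase; staircase-distance)

-- Every distance is at most 0 + 1 + ⋯ + (n−1) = C(n,2), and the staircase
-- pair attains it.
mainTheorem1 : (n : ℕ) → 1 ≤ n → Diameter (circM n) (n C 2)
mainTheorem1 n _ = every-pair , origin , staircase ,
                   subst (Distance (circM n) origin staircase) triangle≡C2 (staircase-distance n)
  where
  triangle≡C2 : triangle n ≡ n C 2
  triangle≡C2 = sym (C2≡triangle n)
  every-pair : ∀ (u v : Vecℤ n) → Σ ℕ λ d → d ≤ n C 2 × Distance (circM n) u v d
  every-pair u v = let d , d≤triangle , distance = distance-bounded u v in
                   d , subst (d ≤_) triangle≡C2 d≤triangle , distance
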